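{- Let $p$ be a prime. (1) If $p\equiv 1\pmod{12}$ or $p\equiv 7\pmod{12}$, then $H_{p,k}\equiv 0\pmod 2$ for $1\le k\le p$. (2) If $p\equiv 5\pmod{12}$, then $H_{p,4t+1}\equiv 0\pmod 3$ for $t=0,1,2,\ldots,\lfloor p/4\rfloor$. (3) If $p\equiv 11\pmod{12}$, then $H_{p,4t+2}\equiv 0\pmod 3$ for $t=0,1,2,\ldots,\lfloor p/4\rfloor$.
   Context: $F_n$ denotes the Fibonacci numbers ($F_0=0$, $F_1=1$, $F_{n}=F_{n-1}+F_{n-2}$), extended to negative indices by $F_{ -n}=(-1)^{n-1}F_n$. For integers $r,k$, $H_{r,k}=F_{k+1}F_{r-k+2}-F_kF_{r-k+1}=F_{k-1}F_{r-k+2}+F_kF_{r-k}$. -}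

module Defs where

open import Data.Nat as ℕ using (ℕ; zero; suc)
open import Data.Integer using (ℤ; +_; -[1+_]; _+_; _-_; _*_; -_)

fibℕ : ℕ → ℕ
fibℕ zero = zero
fibℕ (suc zero) = suc zero
fibℕ (suc (suc n)) = fibℕ (suc n) ℕ.+ fibℕ n

-- sign (-1)^(n-1) for n ≥ 1, encoded via m = n - 1: (-1)^m
negPow : ℕ → ℤ → ℤ
negPow zero x = x
negPow (suc m) x = - negPow m x

F : ℤ → ℤ
F (+ n) = + fibℕ n
F -[1+ m ] = negPow m (+ fibℕ (suc m))

H : ℤ → ℤ → ℤ
H r k = F (k + + 1) * F (r - k + + 2) - F k * F (r - k + + 1)

-- Writing
-- p = k + m, H_{p,k} is F_{k+1} F_{m+2} - F_k F_{m+1}.  Fibonacci numbers are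
-- periodic modulo 2 with period 3 and modulo 3 with period 8 (a period P mod d
-- is certified by F_P ≡ 0 and F_{P-1} ≡ 1, via the addition law).  So whether
-- d divides H_{k+m,k} depends only on k and m modulo the period, and the
-- residue conditions of each case leave finitely many pairs, checked by
-- computation.
module Submission where

open import Defs
open import Data.Nat using (ℕ; _≤_; _%_; _/_)
open import Data.Nat.Primality using (Prime)
open import Data.Integer using (+_; _+_; _*_)
open import Data.Integer.Divisibility using (_∣_)
open import Data.Product using (_×_)
open import Data.Sum using (_⊎_)
open import Relation.Binary.PropositionalEquality using (_≡_)

open import Data.Nat as ℕ using (suc; _<_; _∸_; NonZero; s≤s; z≤n; _≟_; allUpTo?)
open import Data.Nat.Properties
  using (+-comm; +-assoc; *-comm; m+[n∸m]≡n; +-mono-≤; *-monoʳ-≤; module ≤-Reasoning)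
open import Data.Nat.DivMod
  using (m≡m%n+[m/n]*n; m%n<n; [m+kn]%n≡m%n; %-distribˡ-+; %-distribˡ-*; m∣n⇒o%n%m≡o%m)
import Data.Nat.Divisibility as ℕ
open import Data.Nat.Tactic.RingSolver using (solve-∀)
open import Data.Integer using (_-_)
open import Data.Integer.Properties using (pos-*)
import Data.Integer.Tactic.RingSolver as ℤ-Solver
open import Data.Integer.Divisibility.Signed as Signed using (∣⇒∣ᵤ; ∣n⇒∣m*n; ∣-refl)
open import Data.Product using (_,_)
open import Data.Sum using (inj₁; inj₂)
open import Relation.Nullary.Decidable using (Dec; True; toWitness; from-yes; _→-dec_; _×-dec_)
open import Relation.Binary.PropositionalEquality
  using (refl; sym; trans; cong; cong₂; subst; module ≡-Reasoning)

%-cong-* : ∀ {a a′ b b′} d .{{_ : NonZero d}} →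
  a % d ≡ a′ % d → b % d ≡ b′ % d → a ℕ.* b % d ≡ a′ ℕ.* b′ % d
%-cong-* {a} {a′} {b} {b′} d a≡a′ b≡b′ = begin
  a ℕ.* b % d                   ≡⟨ %-distribˡ-* a b d ⟩
  (a % d) ℕ.* (b % d) % d       ≡⟨ cong₂ (λ u v → u ℕ.* v % d) a≡a′ b≡b′ ⟩
  (a′ % d) ℕ.* (b′ % d) % d     ≡⟨ sym (%-distribˡ-* a′ b′ d) ⟩
  a′ ℕ.* b′ % d                 ∎
  where open ≡-Reasoning

m∣n⇒o%n≡r⇒o%m≡r%m : ∀ m n .{{_ : NonZero m}} .{{_ : NonZero n}} → m ℕ.∣ n →
  ∀ o {r} → o % n ≡ r → o % m ≡ r % m
m∣n⇒o%n≡r⇒o%m≡r%m m n m∣n o o≡r = trans (sym (m∣n⇒o%n%m≡o%m m n o m∣n)) (cong (_% m) o≡r)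

m∣n⇒[o%n+p%n]%m≡[o+p]%m : ∀ m n .{{_ : NonZero m}} .{{_ : NonZero n}} → m ℕ.∣ n →
  ∀ o p → (o % n ℕ.+ p % n) % m ≡ (o ℕ.+ p) % m
m∣n⇒[o%n+p%n]%m≡[o+p]%m m n m∣n o p = begin
  (o % n ℕ.+ p % n) % m         ≡⟨ %-distribˡ-+ (o % n) (p % n) m ⟩
  (o % n % m ℕ.+ p % n % m) % m ≡⟨ cong₂ (λ u v → (u ℕ.+ v) % m) (m∣n⇒o%n%m≡o%m m n o m∣n) (m∣n⇒o%n%m≡o%m m n p m∣n) ⟩
  (o % m ℕ.+ p % m) % m         ≡⟨ sym (%-distribˡ-+ o p m) ⟩
  (o ℕ.+ p) % m                 ∎
  where open ≡-Reasoning

%≡%⇒∣- : ∀ d .{{_ : NonZero d}} x y → x % d ≡ y % d → + d ∣ + x - + y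
%≡%⇒∣- d x y x≡y = ∣⇒∣ᵤ (subst (Signed._∣_ (+ d)) (sym x-y≡qd) (∣n⇒∣m*n (+ (x / d) - + (y / d)) ∣-refl))
  where
    open ≡-Reasoning
    r : ℕ
    r = x % d
    split : ∀ r q → + (r ℕ.+ q ℕ.* d) ≡ + r + + q * + d
    split r q = cong (_+_ (+ r)) (pos-* q d)
    cancel : ∀ r a b n → (r + a * n) - (r + b * n) ≡ (a - b) * n
    cancel = ℤ-Solver.solve-∀
    x-y≡qd : + x - + y ≡ (+ (x / d) - + (y / d)) * + d
    x-y≡qd = begin
      + x - + y
        ≡⟨ cong₂ (λ u v → + u - + v) (m≡m%n+[m/n]*n x d) (m≡m%n+[m/n]*n y d) ⟩
      + (r ℕ.+ x / d ℕ.* d) - + (y % d ℕ.+ y / d ℕ.* d)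
        ≡⟨ cong (λ s → + (r ℕ.+ x / d ℕ.* d) - + (s ℕ.+ y / d ℕ.* d)) (sym x≡y) ⟩
      + (r ℕ.+ x / d ℕ.* d) - + (r ℕ.+ y / d ℕ.* d)
        ≡⟨ cong₂ _-_ (split r (x / d)) (split r (y / d)) ⟩
      (+ r + + (x / d) * + d) - (+ r + + (y / d) * + d)
        ≡⟨ cancel (+ r) (+ (x / d)) (+ (y / d)) (+ d) ⟩
      (+ (x / d) - + (y / d)) * + d ∎

fib-+ : ∀ n x → fibℕ (suc n ℕ.+ x) ≡ fibℕ (suc n) ℕ.* fibℕ (suc x) ℕ.+ fibℕ n ℕ.* fibℕ x
fib-+ 0 x = base (fibℕ (suc x)) (fibℕ x)
  where base : ∀ a b → a ≡ 1 ℕ.* a ℕ.+ 0 ℕ.* b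
        base = solve-∀
fib-+ 1 x = base (fibℕ (suc x)) (fibℕ x)
  where base : ∀ a b → a ℕ.+ b ≡ 1 ℕ.* a ℕ.+ 1 ℕ.* b
        base = solve-∀
fib-+ (suc (suc n)) x =
  trans (cong₂ ℕ._+_ (fib-+ (suc n) x) (fib-+ n x))
        (collect (fibℕ (suc (suc n))) (fibℕ (suc n)) (fibℕ n) (fibℕ (suc x)) (fibℕ x))
  where
    collect : ∀ f₂ f₁ f₀ a b →
      (f₂ ℕ.* a ℕ.+ f₁ ℕ.* b) ℕ.+ (f₁ ℕ.* a ℕ.+ f₀ ℕ.* b) ≡ (f₂ ℕ.+ f₁) ℕ.* a ℕ.+ (f₁ ℕ.+ f₀) ℕ.* b
    collect = solve-∀

FibPeriod : (d : ℕ) .{{_ : NonZero d}} → ℕ → Set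
FibPeriod d P = ∀ x → fibℕ (P ℕ.+ x) % d ≡ fibℕ x % d

fib-period : ∀ n d a b .{{_ : NonZero d}} →
  fibℕ (suc n) ≡ a ℕ.* d → fibℕ n ≡ 1 ℕ.+ b ℕ.* d → FibPeriod d (suc n)
fib-period n d a b Fₙ₊₁≡ad Fₙ≡1+bd x = begin
  fibℕ (suc n ℕ.+ x) % d
    ≡⟨ cong (_% d) (fib-+ n x) ⟩
  (fibℕ (suc n) ℕ.* fibℕ (suc x) ℕ.+ fibℕ n ℕ.* fibℕ x) % d
    ≡⟨ cong₂ (λ u v → (u ℕ.* fibℕ (suc x) ℕ.+ v ℕ.* fibℕ x) % d) Fₙ₊₁≡ad Fₙ≡1+bd ⟩
  (a ℕ.* d ℕ.* fibℕ (suc x) ℕ.+ (1 ℕ.+ b ℕ.* d) ℕ.* fibℕ x) % d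
    ≡⟨ cong (_% d) (regroup a b d (fibℕ (suc x)) (fibℕ x)) ⟩
  (fibℕ x ℕ.+ (a ℕ.* fibℕ (suc x) ℕ.+ b ℕ.* fibℕ x) ℕ.* d) % d
    ≡⟨ [m+kn]%n≡m%n (fibℕ x) (a ℕ.* fibℕ (suc x) ℕ.+ b ℕ.* fibℕ x) d ⟩
  fibℕ x % d ∎
  where
    open ≡-Reasoning
    regroup : ∀ a b d u v →
      a ℕ.* d ℕ.* u ℕ.+ (1 ℕ.+ b ℕ.* d) ℕ.* v ≡ v ℕ.+ (a ℕ.* u ℕ.+ b ℕ.* v) ℕ.* d
    regroup = solve-∀

fib-period-2 : FibPeriod 2 3
fib-period-2 = fib-period 2 2 1 0 refl refl

fib-period-3 : FibPeriod 3 8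
fib-period-3 = fib-period 7 3 7 4 refl refl

H[k+m,k]≡ : ∀ k m →
  H (+ (k ℕ.+ m)) (+ k) ≡ + (fibℕ (1 ℕ.+ k) ℕ.* fibℕ (2 ℕ.+ m)) - + (fibℕ k ℕ.* fibℕ (1 ℕ.+ m))
H[k+m,k]≡ k m = begin
  H (+ (k ℕ.+ m)) (+ k)
    ≡⟨ cong (λ r → F (+ k + + 1) * F (r + + 2) - F (+ k) * F (r + + 1)) (k+m-k≡m (+ k) (+ m)) ⟩
  + fibℕ (k ℕ.+ 1) * + fibℕ (m ℕ.+ 2) - + fibℕ k * + fibℕ (m ℕ.+ 1)
    ≡⟨ cong₂ (λ u v → + fibℕ u * + fibℕ v - + fibℕ k * + fibℕ (m ℕ.+ 1)) (+-comm k 1) (+-comm m 2) ⟩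
  + fibℕ (1 ℕ.+ k) * + fibℕ (2 ℕ.+ m) - + fibℕ k * + fibℕ (m ℕ.+ 1)
    ≡⟨ cong (λ v → + fibℕ (1 ℕ.+ k) * + fibℕ (2 ℕ.+ m) - + fibℕ k * + fibℕ v) (+-comm m 1) ⟩
  + fibℕ (1 ℕ.+ k) * + fibℕ (2 ℕ.+ m) - + fibℕ k * + fibℕ (1 ℕ.+ m)
    ≡⟨ sym (cong₂ _-_ (pos-* (fibℕ (1 ℕ.+ k)) (fibℕ (2 ℕ.+ m))) (pos-* (fibℕ k) (fibℕ (1 ℕ.+ m)))) ⟩
  + (fibℕ (1 ℕ.+ k) ℕ.* fibℕ (2 ℕ.+ m)) - + (fibℕ k ℕ.* fibℕ (1 ℕ.+ m)) ∎
  where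
    open ≡-Reasoning
    k+m-k≡m : ∀ k m → k + m - k ≡ m
    k+m-k≡m = ℤ-Solver.solve-∀

HVanishesMod : (d : ℕ) .{{_ : NonZero d}} → ℕ → ℕ → Set
HVanishesMod d k m = fibℕ (1 ℕ.+ k) ℕ.* fibℕ (2 ℕ.+ m) % d ≡ fibℕ k ℕ.* fibℕ (1 ℕ.+ m) % d

HVanishesMod⇒∣H : ∀ {d} .{{_ : NonZero d}} k m → HVanishesMod d k m → + d ∣ H (+ (k ℕ.+ m)) (+ k)
HVanishesMod⇒∣H {d} k m h = subst (+ d ∣_) (sym (H[k+m,k]≡ k m)) (%≡%⇒∣- d _ _ h)

module _ {d P : ℕ} .{{_ : NonZero d}} (period : FibPeriod d P) where

  fib-+-multiple : ∀ r q → fibℕ (r ℕ.+ q ℕ.* P) % d ≡ fibℕ r % d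
  fib-+-multiple r 0 = cong (λ n → fibℕ n % d) (+-comm r 0)
  fib-+-multiple r (suc q) = begin
    fibℕ (r ℕ.+ (P ℕ.+ q ℕ.* P)) % d ≡⟨ cong (λ n → fibℕ n % d) (swap r P (q ℕ.* P)) ⟩
    fibℕ (P ℕ.+ (r ℕ.+ q ℕ.* P)) % d ≡⟨ period (r ℕ.+ q ℕ.* P) ⟩
    fibℕ (r ℕ.+ q ℕ.* P) % d         ≡⟨ fib-+-multiple r q ⟩
    fibℕ r % d                        ∎
    where
      open ≡-Reasoning
      swap : ∀ a b c → a ℕ.+ (b ℕ.+ c) ≡ b ℕ.+ (a ℕ.+ c)
      swap = solve-∀

  fib-+-mod : .{{_ : NonZero P}} → ∀ c n → fibℕ (c ℕ.+ n) % d ≡ fibℕ (c ℕ.+ n % P) % d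
  fib-+-mod c n = begin
    fibℕ (c ℕ.+ n) % d
      ≡⟨ cong (λ n′ → fibℕ (c ℕ.+ n′) % d) (m≡m%n+[m/n]*n n P) ⟩
    fibℕ (c ℕ.+ (n % P ℕ.+ n / P ℕ.* P)) % d
      ≡⟨ cong (λ n′ → fibℕ n′ % d) (sym (+-assoc c (n % P) (n / P ℕ.* P))) ⟩
    fibℕ (c ℕ.+ n % P ℕ.+ n / P ℕ.* P) % d
      ≡⟨ fib-+-multiple (c ℕ.+ n % P) (n / P) ⟩
    fibℕ (c ℕ.+ n % P) % d ∎
    where open ≡-Reasoning

  HVanishesMod-reduce : .{{_ : NonZero P}} → ∀ k m → HVanishesMod d (k % P) (m % P) → HVanishesMod d k m
  HVanishesMod-reduce k m h = begin
    fibℕ (1 ℕ.+ k) ℕ.* fibℕ (2 ℕ.+ m) % d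
      ≡⟨ %-cong-* d (fib-+-mod 1 k) (fib-+-mod 2 m) ⟩
    fibℕ (1 ℕ.+ k % P) ℕ.* fibℕ (2 ℕ.+ m % P) % d
      ≡⟨ h ⟩
    fibℕ (k % P) ℕ.* fibℕ (1 ℕ.+ m % P) % d
      ≡⟨ sym (%-cong-* d (fib-+-mod 0 k) (fib-+-mod 1 m)) ⟩
    fibℕ k ℕ.* fibℕ (1 ℕ.+ m) % d ∎
    where open ≡-Reasoning

  ∣H-by-residues : .{{_ : NonZero P}} → (C : ℕ → ℕ → Set) →
    (∀ {i} → i < P → ∀ {j} → j < P → C i j → HVanishesMod d i j) →
    ∀ {k p} → k ≤ p → C (k % P) ((p ∸ k) % P) → + d ∣ H (+ p) (+ k)
  ∣H-by-residues C table {k} {p} k≤p c =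
    subst (λ n → + d ∣ H (+ n) (+ k)) (m+[n∸m]≡n k≤p)
      (HVanishesMod⇒∣H k (p ∸ k)
        (HVanishesMod-reduce k (p ∸ k) (table (m%n<n k P) (m%n<n (p ∸ k) P) c)))

HVanishesMod? : ∀ d .{{_ : NonZero d}} k m → Dec (HVanishesMod d k m)
HVanishesMod? d k m = _ ≟ _

HVanishesMod-table? : ∀ d P .{{_ : NonZero d}} (C : ℕ → ℕ → Set) → (∀ i j → Dec (C i j)) →
  Dec (∀ {i} → i < P → ∀ {j} → j < P → C i j → HVanishesMod d i j)
HVanishesMod-table? d P C C? =
  allUpTo? (λ i → allUpTo? (λ j → C? i j →-dec HVanishesMod? d i j) P) P

H-even : ∀ {p} → p % 3 ≡ 1 → ∀ {k} → k ≤ p → + 2 ∣ H (+ p) (+ k)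
H-even {p} p≡1 {k} k≤p = ∣H-by-residues fib-period-2 SumIs1
    (from-yes (HVanishesMod-table? 2 3 SumIs1 (λ i j → (i ℕ.+ j) % 3 ≟ 1))) k≤p (begin
  (k % 3 ℕ.+ (p ∸ k) % 3) % 3 ≡⟨ m∣n⇒[o%n+p%n]%m≡[o+p]%m 3 3 ℕ.∣-refl k (p ∸ k) ⟩
  (k ℕ.+ (p ∸ k)) % 3         ≡⟨ cong (_% 3) (m+[n∸m]≡n k≤p) ⟩
  p % 3                       ≡⟨ p≡1 ⟩
  1                           ∎)
  where
    open ≡-Reasoning
    SumIs1 : ℕ → ℕ → Set
    SumIs1 i j = (i ℕ.+ j) % 3 ≡ 1

4t+c≤p : ∀ {p t c} → t ≤ p / 4 → c ≤ p % 4 → 4 ℕ.* t ℕ.+ c ≤ p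
4t+c≤p {p} {t} {c} t≤ c≤ = begin
  4 ℕ.* t ℕ.+ c           ≤⟨ +-mono-≤ (*-monoʳ-≤ 4 t≤) c≤ ⟩
  4 ℕ.* (p / 4) ℕ.+ p % 4 ≡⟨ +-comm (4 ℕ.* (p / 4)) (p % 4) ⟩
  p % 4 ℕ.+ 4 ℕ.* (p / 4) ≡⟨ cong (p % 4 ℕ.+_) (*-comm 4 (p / 4)) ⟩
  p % 4 ℕ.+ p / 4 ℕ.* 4   ≡⟨ sym (m≡m%n+[m/n]*n p 4) ⟩
  p                       ∎
  where open ≤-Reasoning

H-divisible-by-3 : ∀ {p} c e → p % 4 ≡ e → c ≤ e →
  let C : ℕ → ℕ → Set
      C i j = i % 4 ≡ c % 4 × (i ℕ.+ j) % 4 ≡ e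
  in {True (HVanishesMod-table? 3 8 C (λ i j → (i % 4 ≟ c % 4) ×-dec ((i ℕ.+ j) % 4 ≟ e)))} →
  ∀ t → t ≤ p / 4 → + 3 ∣ H (+ p) (+ 4 * + t + + c)
H-divisible-by-3 {p} c e p≡e c≤e {table} t t≤ =
  subst (λ z → + 3 ∣ H (+ p) (z + + c)) (pos-* 4 t)
    (∣H-by-residues fib-period-3 _ (toWitness table) k≤p (k-residue , sum-residue))
  where
    open ≡-Reasoning
    k : ℕ
    k = 4 ℕ.* t ℕ.+ c
    k≤p : k ≤ p
    k≤p = 4t+c≤p t≤ (subst (c ≤_) (sym p≡e) c≤e)
    k-residue : k % 8 % 4 ≡ c % 4
    k-residue = begin
      k % 8 % 4          ≡⟨ m∣n⇒o%n%m≡o%m 4 8 k (ℕ.divides 2 refl) ⟩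
      k % 4              ≡⟨ cong (_% 4) (trans (+-comm (4 ℕ.* t) c) (cong (c ℕ.+_) (*-comm 4 t))) ⟩
      (c ℕ.+ t ℕ.* 4) % 4 ≡⟨ [m+kn]%n≡m%n c t 4 ⟩
      c % 4              ∎
    sum-residue : (k % 8 ℕ.+ (p ∸ k) % 8) % 4 ≡ e
    sum-residue = begin
      (k % 8 ℕ.+ (p ∸ k) % 8) % 4 ≡⟨ m∣n⇒[o%n+p%n]%m≡[o+p]%m 4 8 (ℕ.divides 2 refl) k (p ∸ k) ⟩
      (k ℕ.+ (p ∸ k)) % 4         ≡⟨ cong (_% 4) (m+[n∸m]≡n k≤p) ⟩
      p % 4                       ≡⟨ p≡e ⟩
      e                           ∎

corollary2p11 : (p : ℕ) → Prime p →
    (((p % 12 ≡ 1 ⊎ p % 12 ≡ 7) → (k : ℕ) → 1 ≤ k → k ≤ p → + 2 ∣ H (+ p) (+ k))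
    × ((p % 12 ≡ 5) → (t : ℕ) → t ≤ p / 4 → + 3 ∣ H (+ p) (+ 4 * + t + + 1))
    × ((p % 12 ≡ 11) → (t : ℕ) → t ≤ p / 4 → + 3 ∣ H (+ p) (+ 4 * + t + + 2)))
corollary2p11 p _ =
    (λ p≡1∨7 _ _ → H-even (p%3≡1 p≡1∨7))
  , (λ p≡5 → H-divisible-by-3 1 1 (m∣n⇒o%n≡r⇒o%m≡r%m 4 12 (ℕ.divides 3 refl) p p≡5) (s≤s z≤n))
  , (λ p≡11 → H-divisible-by-3 2 3 (m∣n⇒o%n≡r⇒o%m≡r%m 4 12 (ℕ.divides 3 refl) p p≡11) (s≤s (s≤s z≤n)))
  where
    p%3≡1 : p % 12 ≡ 1 ⊎ p % 12 ≡ 7 → p % 3 ≡ 1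
    p%3≡1 (inj₁ p≡1) = m∣n⇒o%n≡r⇒o%m≡r%m 3 12 (ℕ.divides 4 refl) p p≡1
    p%3≡1 (inj₂ p≡7) = m∣n⇒o%n≡r⇒o%m≡r%m 3 12 (ℕ.divides 4 refl) p p≡7
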